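{- Let $D=(V,A)$ be an acyclic digraph with $V=[n]$, let $L=L_D$ be the bijection produced by Algorithm A, and let $a,b,c$ be distinct vertices of $D$. (i) If $c\not\approx_D b$, then $L(c)<L(b)$ if and only if $\min(N_D[c,b])<\min(N_D[b,c])$. (ii) If $c\not\approx_D b$, $L(c)<L(b)$ and $b<c$, then there exist $a,c'\in R_D[c]\setminus R_D[b]$ such that $\{a,b,c'\}\in\mathcal{W}(D)$. (iii) If $\mathcal{W}(D)=\emptyset$, $b<c$ and $c\not\prec_D b$, then $L(b)<L(c)$.
   Context: For distinct $u,v$, $u\prec_D v$ means $D$ has a directed path from $u$ to $v$; $u\not\approx_D v$ means neither $u\prec_D v$ nor $v\prec_D u$. $R_D(u)=\{v\in V: u\prec_D v\}$ and $R_D[u]=R_D(u)\cup\{u\}$. A sink of a digraph is a vertex with no out-going arc. Algorithm A defines $L:V\to[n]$: set $S:=V$; repeatedly let $u$ be the largest number among all sinks of the induced subdigraph $D[S]$, set $L(u):=|S|$ and $S:=S\setminus\{u\}$, until $S=\emptyset$. For distinct vertices $b,c$, $N_D[c,b]=\{c'\in R_D[c]\setminus R_D[b]: L(c')<L(y)\ \text{for all } y\in R_D(c)\cap R_D(b)\}$. $\mathcal{W}(D)$ is the set of $3$-element subsets $\{a,b,c\}\subseteq V$ with $a<b<c$, $(c,a)\in A$, $a\not\approx_D b$ and $c\not\approx_D b$. -}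

module Defs where

open import Data.Nat using (ℕ; zero; suc)
open import Data.Bool using (Bool; true; false; _∧_; not; if_then_else_; T)
open import Data.Maybe using (Maybe; just; nothing)
open import Data.Fin using (Fin; zero; suc; _≟_) renaming (_<_ to _<ᶠ_; _≤_ to _≤ᶠ_)
open import Data.Fin.Subset using (Subset; ⊤; _-_; ∣_∣)
open import Data.Vec using (lookup)
open import Data.Product using (_×_; ∃; ∃-syntax)
open import Data.Sum using (_⊎_)
open import Relation.Nullary using (¬_; does)
open import Relation.Binary.PropositionalEquality using (_≡_; _≢_)

Digraph : ℕ → Set
Digraph n = Fin n → Fin n → Bool

Arc : ∀ {n} → Digraph n → Fin n → Fin n → Set
Arc D u v = T (D u v)

data Path {n} (D : Digraph n) : Fin n → Fin n → Set where
  edge : ∀ {u v} → Arc D u v → Path D u v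
  cons : ∀ {u v w} → Arc D u v → Path D v w → Path D u w

Acyclic : ∀ {n} → Digraph n → Set
Acyclic D = ∀ u → ¬ Path D u u

Prec : ∀ {n} → Digraph n → Fin n → Fin n → Set
Prec D u v = Path D u v

Incomp : ∀ {n} → Digraph n → Fin n → Fin n → Set
Incomp D u v = ¬ Prec D u v × ¬ Prec D v u

InR : ∀ {n} → Digraph n → Fin n → Fin n → Set
InR D u v = Prec D u v

InR[] : ∀ {n} → Digraph n → Fin n → Fin n → Set
InR[] D u v = InR D u v ⊎ v ≡ u

allᵇ : ∀ {n} → (Fin n → Bool) → Bool
allᵇ {zero}  p = true
allᵇ {suc n} p = p zero ∧ allᵇ (λ i → p (suc i))

findLast : ∀ {n} → (Fin n → Bool) → Maybe (Fin n)
findLast {zero}  p = nothing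
findLast {suc n} p with findLast (λ i → p (suc i))
... | just i  = just (suc i)
... | nothing = if p zero then just zero else nothing

isSinkIn : ∀ {n} → Digraph n → Subset n → Fin n → Bool
isSinkIn D S u = lookup S u ∧ allᵇ (λ v → not (lookup S v ∧ D u v))

largestSink : ∀ {n} → Digraph n → Subset n → Maybe (Fin n)
largestSink D S = findLast (isSinkIn D S)

update : ∀ {n} → (Fin n → ℕ) → Fin n → ℕ → (Fin n → ℕ)
update L u k v = if does (v ≟ u) then k else L v

algA-go : ∀ {n} → Digraph n → ℕ → Subset n → (Fin n → ℕ) → (Fin n → ℕ)
algA-go D zero    S L = L
algA-go D (suc k) S L with largestSink D S
... | nothing = L
... | just u  = algA-go D k (S - u) (update L u ∣ S ∣)

-- The labelling L_D : V → [n] produced by Algorithm A (S := V initially;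
-- exactly n rounds are needed).
algA : ∀ {n} → Digraph n → Fin n → ℕ
algA {n} D = algA-go D n ⊤ (λ _ → 0)

InN : ∀ {n} → Digraph n → Fin n → Fin n → Fin n → Set
InN D c b c' =
  InR[] D c c' × ¬ InR[] D b c' ×
  (∀ y → InR D c y → InR D b y → algA D c' Data.Nat.< algA D y)

IsMin : ∀ {n} → (Fin n → Set) → Fin n → Set
IsMin P m = P m × (∀ x → P x → m ≤ᶠ x)

-- (x , y , z) with x < y < z represents {x,y,z} ∈ 𝒲(D)
InW : ∀ {n} → Digraph n → Fin n → Fin n → Fin n → Set
InW D x y z = x <ᶠ y × y <ᶠ z × Arc D z x × Incomp D x y × Incomp D z y

InWSet : ∀ {n} → Digraph n → Fin n → Fin n → Fin n → Set
InWSet D u v w =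
  InW D u v w ⊎ InW D u w v ⊎ InW D v u w ⊎
  InW D v w u ⊎ InW D w u v ⊎ InW D w v u

WEmpty : ∀ {n} → Digraph n → Set
WEmpty D = ∀ x y z → ¬ InW D x y z

-- Algorithm A removes the vertices in order of decreasing label, so labels are injective and
-- increase along arcs; moreover, a vertex s with L s ≤ L u all of whose out-neighbours are
-- labelled above L u was a sink when u was removed, hence s ≤ u. Climbing greedily from x
-- along arcs into vertices labelled at most L m therefore ends at some s ∈ R[x] with s ≤ m.
-- (i) If L b < L c, climbing from b below m₁ = min N[c,b] ends inside N[b,c] at a vertex
-- ≤ m₁, so min N[b,c] ≤ m₁; by symmetry this gives the equivalence.
-- (ii) Climbing from c below b ends at some s < b; the path from c > b to s avoids b, so it
-- crosses b along an arc c′ → a′ with a′ < b < c′, and {a′, b, c′} ∈ 𝒲(D).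
-- (iii) follows from (ii).
module Submission where

open import Defs
open import Data.Nat using (ℕ; zero; suc; _+_; _<_; _≤_; _≤?_; z≤n; s≤s)
import Data.Nat.Properties as ℕ
open import Data.Bool using (Bool; true; false; _∧_; not; T)
open import Data.Bool.Properties using (T?; T-≡; T-∧)
open import Data.Unit using (tt)
open import Data.Empty using (⊥-elim)
open import Data.Maybe using (just; nothing)
open import Data.Fin using (Fin; zero; suc; toℕ; _≟_) renaming (_<_ to _<ᶠ_; _≤_ to _≤ᶠ_)
import Data.Fin.Properties as Fin
open import Data.Fin.Subset using (Subset; ⊤; _-_; ∣_∣; ⁅_⁆; _∈_; _∉_)
open import Data.Fin.Subset.Properties using (_∈?_; ∈⊤; ∣⊤∣≡n; p─q⊆p; x∈p∧x≢y⇒x∈p-y; x∈p⇒∣p-x∣<∣p∣)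
open import Data.Vec using (lookup; _∷_; there)
open import Data.Vec.Properties using ([]=⇒lookup; lookup⇒[]=)
open import Data.Product using (_×_; _,_; Σ; ∃-syntax; proj₁; proj₂)
open import Data.Sum using (_⊎_; inj₁; inj₂)
open import Function using (_∘_)
open import Function.Bundles using (_⇔_; mk⇔; Equivalence)
open import Relation.Nullary using (¬_; yes; no)
open import Relation.Nullary.Decidable using (_×-dec_; dec-true; dec-false)
open import Relation.Binary.PropositionalEquality using (_≡_; _≢_; refl; sym; trans; subst)
open import Relation.Binary.Definitions using (tri<; tri≈; tri>)

open Equivalence using (to; from)

T-allᵇ : ∀ {n} (p : Fin n → Bool) → T (allᵇ p) ⇔ (∀ i → T (p i))
T-allᵇ {zero}  p = mk⇔ (λ _ ()) (λ _ → tt)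
T-allᵇ {suc n} p = mk⇔ all-p (λ ∀p → from T-∧ (∀p zero , from rest (∀p ∘ suc)))
  where
  rest : T (allᵇ (λ i → p (suc i))) ⇔ (∀ i → T (p (suc i)))
  rest = T-allᵇ (λ i → p (suc i))
  all-p : T (allᵇ p) → ∀ i → T (p i)
  all-p t zero    = proj₁ (to T-∧ t)
  all-p t (suc i) = to rest (proj₂ (to T-∧ t)) i

findLast-nothing : ∀ {n} (p : Fin n → Bool) → findLast p ≡ nothing → ∀ i → ¬ T (p i)
findLast-nothing {suc n} p e i with findLast (λ i → p (suc i)) in eq
findLast-nothing {suc n} p () i | just _
... | nothing with p zero in p0
findLast-nothing {suc n} p () i      | nothing | true
findLast-nothing {suc n} p e zero    | nothing | false = subst T p0
findLast-nothing {suc n} p e (suc i) | nothing | false = findLast-nothing (λ i → p (suc i)) eq i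

findLast-just : ∀ {n} (p : Fin n → Bool) {u} → findLast p ≡ just u →
                T (p u) × (∀ {i} → T (p i) → i ≤ᶠ u)
findLast-just {suc n} p e with findLast (λ i → p (suc i)) in eq
findLast-just {suc n} p refl | just u =
  proj₁ last , λ { {zero} _ → z≤n ; {suc i} t → s≤s (proj₂ last t) }
  where
  last : T (p (suc u)) × (∀ {i} → T (p (suc i)) → i ≤ᶠ u)
  last = findLast-just (λ i → p (suc i)) eq
... | nothing with p zero in p0
findLast-just {suc n} p refl | nothing | true =
  subst T (sym p0) tt ,
  λ { {zero} _ → z≤n ; {suc i} t → ⊥-elim (findLast-nothing (λ i → p (suc i)) eq i t) }
findLast-just {suc n} p ()   | nothing | false

T-not⇔¬T : ∀ {b} → T (not b) ⇔ (¬ T b)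
T-not⇔¬T {false} = mk⇔ (λ _ ()) (λ _ → tt)
T-not⇔¬T {true}  = mk⇔ (λ ()) (λ ¬t → ¬t tt)

∈⇔T-lookup : ∀ {n} {S : Subset n} {v} → v ∈ S ⇔ T (lookup S v)
∈⇔T-lookup {S = S} {v} = mk⇔ (from T-≡ ∘ []=⇒lookup) (lookup⇒[]= v S ∘ to T-≡)

x∉p-x : ∀ {n} (p : Subset n) x → x ∉ p - x
x∉p-x (_ ∷ p) zero    ()
x∉p-x (_ ∷ p) (suc x) (there x∈p-x) = x∉p-x p x x∈p-x

∈⇒≡∨∈- : ∀ {n} {S : Subset n} {v} u → v ∈ S → v ≡ u ⊎ v ∈ S - u
∈⇒≡∨∈- {v = v} u v∈S with v ≟ u
... | yes v≡u = inj₁ v≡u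
... | no  v≢u = inj₂ (x∈p∧x≢y⇒x∈p-y v∈S v≢u)

module _ {n} {D : Digraph n} where

  _++ᵖ_ : ∀ {u v w} → Path D u v → Path D v w → Path D u w
  edge a   ++ᵖ q = cons a q
  cons a p ++ᵖ q = cons a (p ++ᵖ q)

  R[]-◅◅ : ∀ {u v w} → InR[] D u v → Prec D v w → Prec D u w
  R[]-◅◅ (inj₁ p)    q = p ++ᵖ q
  R[]-◅◅ (inj₂ refl) q = q

  arc-◅-R[] : ∀ {u v w} → Arc D u v → InR[] D v w → Prec D u w
  arc-◅-R[] a (inj₁ p)    = cons a p
  arc-◅-R[] a (inj₂ refl) = edge a

  path-crosses : ∀ {u x b} → Path D u x → ¬ Prec D u b → x <ᶠ b → b <ᶠ u →
                 ∃[ a′ ] ∃[ c′ ] (Arc D c′ a′ × a′ <ᶠ b × b <ᶠ c′ × InR[] D u c′ × InR[] D a′ x)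
  path-crosses {u} {x} (edge arc) _ x<b b<u = x , u , arc , x<b , b<u , inj₂ refl , inj₂ refl
  path-crosses {u} {b = b} (cons {v = v} arc p) u⊀b x<b b<u with Fin.<-cmp v b
  ... | tri< v<b _ _  = v , u , arc , v<b , b<u , inj₂ refl , inj₁ p
  ... | tri≈ _ refl _ = ⊥-elim (u⊀b (edge arc))
  ... | tri> _ _ b<v with path-crosses p (u⊀b ∘ cons arc) x<b b<v
  ...   | a′ , c′ , arc′ , a′<b , b<c′ , v≼c′ , a′≼x =
          a′ , c′ , arc′ , a′<b , b<c′ , inj₁ (arc-◅-R[] arc v≼c′) , a′≼x

  acyclic⇒no-infinite-walk : Acyclic D → (w : ℕ → Fin n) → ¬ (∀ k → Arc D (w k) (w (suc k)))
  acyclic⇒no-infinite-walk acyclic w step with Fin.pigeonhole (ℕ.n<1+n n) (w ∘ toℕ)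
  ... | i , j , i<j , wi≡wj =
    acyclic (w (toℕ i)) (subst (Path D (w (toℕ i))) (sym wi≡wj) (walk-path i<j))
    where
    walk-path : ∀ {i j} → i < j → Path D (w i) (w j)
    walk-path {i} {suc j} (s≤s i≤j) with ℕ.m≤n⇒m<n∨m≡n i≤j
    ... | inj₁ i<j  = walk-path i<j ++ᵖ edge (step j)
    ... | inj₂ refl = edge (step i)

SinkIn : ∀ {n} → Digraph n → Subset n → Fin n → Set
SinkIn D S u = u ∈ S × (∀ {v} → v ∈ S → ¬ Arc D u v)

module _ {n} {D : Digraph n} {S : Subset n} where

  T-isSinkIn : ∀ {u} → T (isSinkIn D S u) ⇔ SinkIn D S u
  T-isSinkIn {u} = mk⇔ sound complete
    where
    T-unblocked : T (allᵇ (λ v → not (lookup S v ∧ D u v))) ⇔ (∀ v → T (not (lookup S v ∧ D u v)))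
    T-unblocked = T-allᵇ _
    sound : T (isSinkIn D S u) → SinkIn D S u
    sound t = from ∈⇔T-lookup (proj₁ t′) , λ {v} v∈S arc →
      to T-not⇔¬T (to T-unblocked (proj₂ t′) v) (from T-∧ (to ∈⇔T-lookup v∈S , arc))
      where
      t′ : T (lookup S u) × T (allᵇ (λ v → not (lookup S v ∧ D u v)))
      t′ = to T-∧ t
    complete : SinkIn D S u → T (isSinkIn D S u)
    complete (u∈S , sink) = from T-∧ (to ∈⇔T-lookup u∈S , from T-unblocked λ v →
      from T-not⇔¬T λ t → sink (from ∈⇔T-lookup (proj₁ (to T-∧ t))) (proj₂ (to T-∧ t)))

  sink-or-successor : ∀ {u} → u ∈ S → SinkIn D S u ⊎ ∃[ v ] v ∈ S × Arc D u v
  sink-or-successor {u} u∈S with Fin.any? (λ v → v ∈? S ×-dec T? (D u v))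
  ... | yes successor = inj₂ successor
  ... | no ¬successor = inj₁ (u∈S , λ v∈S arc → ¬successor (_ , v∈S , arc))

  sinkless⇒empty : Acyclic D → (∀ s → ¬ SinkIn D S s) → ∀ {x} → x ∉ S
  sinkless⇒empty acyclic sinkless {x} x∈S =
    acyclic⇒no-infinite-walk acyclic (proj₁ ∘ walk) (λ k → proj₂ (proj₂ (successor (walk k))))
    where
    successor : (u : Σ (Fin n) (_∈ S)) → ∃[ v ] v ∈ S × Arc D (proj₁ u) v
    successor (u , u∈S) with sink-or-successor u∈S
    ... | inj₁ sink = ⊥-elim (sinkless u sink)
    ... | inj₂ step = step
    walk : ℕ → Σ (Fin n) (_∈ S)
    walk zero    = x , x∈S
    walk (suc k) = proj₁ (successor (walk k)) , proj₁ (proj₂ (successor (walk k)))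

  largestSink-just : ∀ {u} → largestSink D S ≡ just u →
                     SinkIn D S u × (∀ {s} → SinkIn D S s → s ≤ᶠ u)
  largestSink-just eq with findLast-just (isSinkIn D S) eq
  ... | t , maximal = to T-isSinkIn t , maximal ∘ from T-isSinkIn

  largestSink-nothing : Acyclic D → largestSink D S ≡ nothing → ∀ {x} → x ∉ S
  largestSink-nothing acyclic eq =
    sinkless⇒empty acyclic (λ s → findLast-nothing (isSinkIn D S) eq s ∘ from T-isSinkIn)

update-same : ∀ {n} (L : Fin n → ℕ) u k → update L u k u ≡ k
update-same L u k rewrite dec-true (u ≟ u) refl = refl

update-other : ∀ {n} (L : Fin n → ℕ) {u v} k → v ≢ u → update L u k v ≡ L v
update-other L {u} {v} k v≢u rewrite dec-false (v ≟ u) v≢u = refl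

algA-go-outside : ∀ {n} (D : Digraph n) k S L {v} → v ∉ S → algA-go D k S L v ≡ L v
algA-go-outside D zero    S L v∉S = refl
algA-go-outside D (suc k) S L v∉S with largestSink D S in eq
... | nothing = refl
... | just u  = trans (algA-go-outside D k (S - u) _ (v∉S ∘ p─q⊆p S ⁅ u ⁆))
                      (update-other L _ λ { refl → v∉S (proj₁ (proj₁ (largestSink-just eq))) })

record IsAlgALabelling {n} (D : Digraph n) (S : Subset n) (L : Fin n → ℕ) : Set where
  field
    ≤-size    : ∀ {v} → v ∈ S → L v ≤ ∣ S ∣
    injective : ∀ {u v} → u ∈ S → v ∈ S → L u ≡ L v → u ≡ v
    arc-<     : ∀ {u v} → u ∈ S → v ∈ S → Arc D u v → L u < L v
    sink-≤    : ∀ {u s} → u ∈ S → s ∈ S → L s ≤ L u →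
                (∀ {v} → v ∈ S → Arc D s v → L u < L v) → s ≤ᶠ u

empty-labelling : ∀ {n} {D : Digraph n} {S L} → (∀ {v} → v ∉ S) → IsAlgALabelling D S L
empty-labelling empty = record
  { ≤-size    = ⊥-elim ∘ empty
  ; injective = λ u∈S _ _ → ⊥-elim (empty u∈S)
  ; arc-<     = λ u∈S _ _ → ⊥-elim (empty u∈S)
  ; sink-≤    = λ u∈S _ _ _ → ⊥-elim (empty u∈S)
  }

remove-largest-sink : ∀ {n} {D : Digraph n} {S u} {L : Fin n → ℕ} → largestSink D S ≡ just u →
                      L u ≡ ∣ S ∣ → IsAlgALabelling D (S - u) L → IsAlgALabelling D S L
remove-largest-sink {D = D} {S} {u} {L} largest Lu≡∣S∣ I = record
  { ≤-size = ≤-size′ ; injective = injective′ ; arc-< = arc-<′ ; sink-≤ = sink-≤′ }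
  where
  open IsAlgALabelling I
  u-sink : SinkIn D S u
  u-sink = proj₁ (largestSink-just largest)
  u-largest : ∀ {s} → SinkIn D S s → s ≤ᶠ u
  u-largest = proj₂ (largestSink-just largest)

  below-u : ∀ {v} → v ∈ S - u → L v < L u
  below-u v∈S-u = ℕ.≤-<-trans (≤-size v∈S-u)
    (subst (∣ S - u ∣ <_) (sym Lu≡∣S∣) (x∈p⇒∣p-x∣<∣p∣ (proj₁ u-sink)))

  ≤-size′ : ∀ {v} → v ∈ S → L v ≤ ∣ S ∣
  ≤-size′ v∈S with ∈⇒≡∨∈- u v∈S
  ... | inj₁ refl    = ℕ.≤-reflexive Lu≡∣S∣
  ... | inj₂ v∈S-u = ℕ.≤-trans (ℕ.<⇒≤ (below-u v∈S-u)) (ℕ.≤-reflexive Lu≡∣S∣)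

  injective′ : ∀ {x y} → x ∈ S → y ∈ S → L x ≡ L y → x ≡ y
  injective′ x∈S y∈S Lx≡Ly with ∈⇒≡∨∈- u x∈S | ∈⇒≡∨∈- u y∈S
  ... | inj₁ refl   | inj₁ refl   = refl
  ... | inj₁ refl   | inj₂ y∈S-u = ⊥-elim (ℕ.<-irrefl (sym Lx≡Ly) (below-u y∈S-u))
  ... | inj₂ x∈S-u | inj₁ refl   = ⊥-elim (ℕ.<-irrefl Lx≡Ly (below-u x∈S-u))
  ... | inj₂ x∈S-u | inj₂ y∈S-u = injective x∈S-u y∈S-u Lx≡Ly

  arc-<′ : ∀ {x y} → x ∈ S → y ∈ S → Arc D x y → L x < L y
  arc-<′ x∈S y∈S arc with ∈⇒≡∨∈- u x∈S | ∈⇒≡∨∈- u y∈S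
  ... | inj₁ refl   | _            = ⊥-elim (proj₂ u-sink y∈S arc)
  ... | inj₂ x∈S-u | inj₁ refl    = below-u x∈S-u
  ... | inj₂ x∈S-u | inj₂ y∈S-u  = arc-< x∈S-u y∈S-u arc

  sink-≤′ : ∀ {x s} → x ∈ S → s ∈ S → L s ≤ L x →
            (∀ {v} → v ∈ S → Arc D s v → L x < L v) → s ≤ᶠ x
  sink-≤′ x∈S s∈S Ls≤Lx above with ∈⇒≡∨∈- u x∈S | ∈⇒≡∨∈- u s∈S
  ... | inj₁ refl   | _            = u-largest (s∈S , λ v∈S arc →
    ℕ.<⇒≱ (above v∈S arc) (ℕ.≤-trans (≤-size′ v∈S) (ℕ.≤-reflexive (sym Lu≡∣S∣))))
  ... | inj₂ x∈S-u | inj₁ refl    = ⊥-elim (ℕ.<⇒≱ (below-u x∈S-u) Ls≤Lx)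
  ... | inj₂ x∈S-u | inj₂ s∈S-u  = sink-≤ x∈S-u s∈S-u Ls≤Lx (above ∘ p─q⊆p S ⁅ u ⁆)

algA-go-labelling : ∀ {n} {D : Digraph n} → Acyclic D →
                    ∀ k S L → ∣ S ∣ ≤ k → IsAlgALabelling D S (algA-go D k S L)
algA-go-labelling acyclic zero S L ∣S∣≤0 =
  empty-labelling (λ v∈S → ℕ.n≮0 (ℕ.<-≤-trans (x∈p⇒∣p-x∣<∣p∣ v∈S) ∣S∣≤0))
algA-go-labelling {n} {D} acyclic (suc k) S L ∣S∣≤1+k with largestSink D S in eq
... | nothing = empty-labelling (largestSink-nothing acyclic eq)
... | just u  = remove-largest-sink eq Lu≡∣S∣ (algA-go-labelling acyclic k (S - u) L′ ∣S-u∣≤k)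
  where
  L′ : Fin n → ℕ
  L′ = update L u ∣ S ∣
  u∈S : u ∈ S
  u∈S = proj₁ (proj₁ (largestSink-just {D = D} eq))
  ∣S-u∣≤k : ∣ S - u ∣ ≤ k
  ∣S-u∣≤k = ℕ.≤-pred (ℕ.<-≤-trans (x∈p⇒∣p-x∣<∣p∣ u∈S) ∣S∣≤1+k)
  Lu≡∣S∣ : algA-go D k (S - u) L′ u ≡ ∣ S ∣
  Lu≡∣S∣ = trans (algA-go-outside D k (S - u) L′ (x∉p-x S u)) (update-same L u ∣ S ∣)

algA-labelling : ∀ {n} {D : Digraph n} → Acyclic D → IsAlgALabelling D ⊤ (algA D)
algA-labelling {n} acyclic = algA-go-labelling acyclic n ⊤ (λ _ → 0) (ℕ.≤-reflexive (∣⊤∣≡n n))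

module AlgA {n} {D : Digraph n} (acyclic : Acyclic D) where

  private
    L : Fin n → ℕ
    L = algA D
    open IsAlgALabelling (algA-labelling acyclic)

  arc⇒label-< : ∀ {u v} → Arc D u v → L u < L v
  arc⇒label-< = arc-< ∈⊤ ∈⊤

  path⇒label-< : ∀ {u v} → Prec D u v → L u < L v
  path⇒label-< (edge arc)   = arc⇒label-< arc
  path⇒label-< (cons arc p) = ℕ.<-trans (arc⇒label-< arc) (path⇒label-< p)

  R[]⇒label-≤ : ∀ {u v} → InR[] D u v → L u ≤ L v
  R[]⇒label-≤ (inj₁ p)    = ℕ.<⇒≤ (path⇒label-< p)
  R[]⇒label-≤ (inj₂ refl) = ℕ.≤-refl

  label-≤⇒¬path : ∀ {u v} → L v ≤ L u → ¬ Prec D u v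
  label-≤⇒¬path Lv≤Lu p = ℕ.<⇒≱ (path⇒label-< p) Lv≤Lu

  label-injective : ∀ {u v} → L u ≡ L v → u ≡ v
  label-injective = injective ∈⊤ ∈⊤

  -- k is fuel: each step raises the label, which stays at most ℓ.
  climb : ∀ ℓ k {x} → ℓ < k + L x → L x ≤ ℓ →
          ∃[ s ] InR[] D x s × L s ≤ ℓ × (∀ {v} → Arc D s v → ℓ < L v)
  climb ℓ zero    ℓ<Lx Lx≤ℓ = ⊥-elim (ℕ.<⇒≱ ℓ<Lx Lx≤ℓ)
  climb ℓ (suc k) {x} ℓ<1+k+Lx Lx≤ℓ with Fin.any? (λ v → T? (D x v) ×-dec (L v ≤? ℓ))
  ... | no ¬step = x , inj₂ refl , Lx≤ℓ , λ {v} arc → ℕ.≰⇒> (λ Lv≤ℓ → ¬step (v , arc , Lv≤ℓ))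
  ... | yes (v , arc , Lv≤ℓ) with climb ℓ k (ℕ.<-≤-trans ℓ<1+k+Lx 1+k+Lx≤k+Lv) Lv≤ℓ
    where
    1+k+Lx≤k+Lv : suc k + L x ≤ k + L v
    1+k+Lx≤k+Lv = subst (_≤ k + L v) (ℕ.+-suc k (L x)) (ℕ.+-monoʳ-≤ k (arc⇒label-< arc))
  ...   | s , v≼s , Ls≤ℓ , top = s , inj₁ (arc-◅-R[] arc v≼s) , Ls≤ℓ , top

  descendant-≤ : ∀ {x} m → L x ≤ L m → ∃[ s ] InR[] D x s × L s ≤ L m × s ≤ᶠ m
  descendant-≤ {x} m Lx≤Lm with climb (L m) (suc (L m)) (s≤s (ℕ.m≤m+n (L m) (L x))) Lx≤Lm
  ... | s , x≼s , Ls≤Lm , top = s , x≼s , Ls≤Lm , sink-≤ ∈⊤ ∈⊤ Ls≤Lm (λ _ → top)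

  N-descendant : ∀ {b c m s} → b ≢ c → Incomp D c b → InN D c b m →
                 InR[] D b s → L s ≤ L m → InN D b c s
  N-descendant {b} {c} {s = s} b≢c (c⊀b , b⊀c) (_ , _ , m-below) b≼s Ls≤Lm =
    b≼s , s∉R[c] b≼s , λ y b≺y c≺y → ℕ.≤-<-trans Ls≤Lm (m-below y c≺y b≺y)
    where
    s∉R[c] : InR[] D b s → ¬ InR[] D c s
    s∉R[c] (inj₁ b≺s) (inj₁ c≺s) = ℕ.<⇒≱ (m-below s c≺s b≺s) Ls≤Lm
    s∉R[c] (inj₁ b≺s) (inj₂ s≡c) = b⊀c (subst (Prec D b) s≡c b≺s)
    s∉R[c] (inj₂ s≡b) (inj₁ c≺s) = c⊀b (subst (Prec D c) s≡b c≺s)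
    s∉R[c] (inj₂ s≡b) (inj₂ s≡c) = b≢c (trans (sym s≡b) s≡c)

  N-min-<⇒label-< : ∀ {b c m₁ m₂ : Fin n} → b ≢ c → Incomp D c b → InN D c b m₁ →
                    (∀ x → InN D b c x → m₂ ≤ᶠ x) → m₁ <ᶠ m₂ → L c < L b
  N-min-<⇒label-< {b} {c} {m₁} b≢c c≉b m₁∈N m₂-lower m₁<m₂ with ℕ.<-cmp (L c) (L b)
  ... | tri< Lc<Lb _ _ = Lc<Lb
  ... | tri≈ _ Lc≡Lb _ = ⊥-elim (b≢c (sym (label-injective Lc≡Lb)))
  ... | tri> _ _ Lb<Lc with descendant-≤ m₁ (ℕ.≤-trans (ℕ.<⇒≤ Lb<Lc) (R[]⇒label-≤ (proj₁ m₁∈N)))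
  ...   | s , b≼s , Ls≤Lm₁ , s≤m₁ =
          ⊥-elim (ℕ.<⇒≱ m₁<m₂ (ℕ.≤-trans (m₂-lower s (N-descendant b≢c c≉b m₁∈N b≼s Ls≤Lm₁)) s≤m₁))

  label-<⇔N-min-< : ∀ {b c m₁ m₂ : Fin n} → b ≢ c → Incomp D c b →
                    IsMin (InN D c b) m₁ → IsMin (InN D b c) m₂ → (L c < L b ⇔ m₁ <ᶠ m₂)
  label-<⇔N-min-< {b} {c} {m₁} {m₂} b≢c c≉b (m₁∈N , m₁-min) (m₂∈N , m₂-min) =
    mk⇔ label-<⇒N-min-< (N-min-<⇒label-< b≢c c≉b m₁∈N m₂-min)
    where
    label-<⇒N-min-< : L c < L b → m₁ <ᶠ m₂
    label-<⇒N-min-< Lc<Lb with Fin.<-cmp m₁ m₂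
    ... | tri< m₁<m₂ _ _  = m₁<m₂
    ... | tri≈ _ m₁≡m₂ _ = ⊥-elim (proj₁ (proj₂ m₁∈N) (subst (InR[] D b) (sym m₁≡m₂) (proj₁ m₂∈N)))
    ... | tri> _ _ m₂<m₁  = ⊥-elim (ℕ.<-asym Lc<Lb
          (N-min-<⇒label-< (b≢c ∘ sym) (proj₂ c≉b , proj₁ c≉b) m₂∈N m₁-min m₂<m₁))

  W-triple : ∀ {b c} → Incomp D c b → L c < L b → b <ᶠ c →
             ∃[ a′ ] ∃[ c′ ] ((InR[] D c a′ × ¬ InR[] D b a′) ×
                              (InR[] D c c′ × ¬ InR[] D b c′) × InW D a′ b c′)
  W-triple {b} {c} (c⊀b , _) Lc<Lb b<c with descendant-≤ b (ℕ.<⇒≤ Lc<Lb)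
  ... | s , inj₂ refl , _ , c≤b = ⊥-elim (ℕ.<⇒≱ b<c c≤b)
  ... | s , inj₁ c≺s , Ls≤Lb , s≤b
        with path-crosses c≺s c⊀b (Fin.≤∧≢⇒< s≤b λ { refl → c⊀b c≺s }) b<c
  ...   | a′ , c′ , arc , a′<b , b<c′ , c≼c′ , a′≼s =
          a′ , c′ , proj₁ a′-off , proj₁ c′-off , a′<b , b<c′ , arc , proj₂ a′-off , proj₂ c′-off
    where
    off-R[b] : ∀ {y} → InR[] D c y → InR[] D y s → y ≢ b →
               (InR[] D c y × ¬ InR[] D b y) × Incomp D y b
    off-R[b] {y} c≼y y≼s y≢b =
      (c≼y , λ { (inj₁ b≺y) → b⊀y b≺y ; (inj₂ y≡b) → y≢b y≡b }) , c⊀b ∘ R[]-◅◅ c≼y , b⊀y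
      where
      b⊀y : ¬ Prec D b y
      b⊀y = label-≤⇒¬path (ℕ.≤-trans (R[]⇒label-≤ y≼s) Ls≤Lb)
    a′-off : (InR[] D c a′ × ¬ InR[] D b a′) × Incomp D a′ b
    a′-off = off-R[b] (inj₁ (R[]-◅◅ c≼c′ (edge arc))) a′≼s (Fin.<⇒≢ a′<b)
    c′-off : (InR[] D c c′ × ¬ InR[] D b c′) × Incomp D c′ b
    c′-off = off-R[b] c≼c′ (inj₁ (arc-◅-R[] arc a′≼s)) (Fin.<⇒≢ b<c′ ∘ sym)

  WEmpty⇒label-< : ∀ {b c} → WEmpty D → b <ᶠ c → ¬ Prec D c b → L b < L c
  WEmpty⇒label-< {b} {c} W≡∅ b<c c⊀b with ℕ.<-cmp (L b) (L c)
  ... | tri< Lb<Lc _ _ = Lb<Lc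
  ... | tri≈ _ Lb≡Lc _ = ⊥-elim (Fin.<⇒≢ b<c (label-injective Lb≡Lc))
  ... | tri> _ _ Lc<Lb with W-triple (c⊀b , label-≤⇒¬path (ℕ.<⇒≤ Lc<Lb)) Lc<Lb b<c
  ...   | a′ , c′ , _ , _ , a′bc′∈W = ⊥-elim (W≡∅ a′ b c′ a′bc′∈W)

proposition2p3 : (n : ℕ) (D : Digraph n) → Acyclic D →
    (a b c : Fin n) → a ≢ b → a ≢ c → b ≢ c →
    ((Incomp D c b →
        ∀ m₁ m₂ → IsMin (InN D c b) m₁ → IsMin (InN D b c) m₂ →
        (algA D c < algA D b ⇔ m₁ <ᶠ m₂))
    × (Incomp D c b → algA D c < algA D b → b <ᶠ c →
        ∃[ a′ ] ∃[ c′ ] ((InR[] D c a′ × ¬ InR[] D b a′) ×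
                         (InR[] D c c′ × ¬ InR[] D b c′) × InWSet D a′ b c′))
    × (WEmpty D → b <ᶠ c → ¬ Prec D c b → algA D b < algA D c))
proposition2p3 n D acyclic a b c _ _ b≢c =
    (λ c≉b _ _ → label-<⇔N-min-< b≢c c≉b)
  , (λ c≉b Lc<Lb b<c → let (a′ , c′ , a′∈ , c′∈ , a′bc′∈W) = W-triple c≉b Lc<Lb b<c
                       in a′ , c′ , a′∈ , c′∈ , inj₁ a′bc′∈W)
  , WEmpty⇒label-<
  where open AlgA acyclic
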